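{- Let $(A,\rightarrow,\rightsquigarrow,1)$ be a pseudo BCK-algebra. The following are equivalent: (a) $A$ is commutative; (b) for all $x,y\in A$: $x\rightarrow y=((y\rightarrow x)\rightsquigarrow x)\rightarrow y$ and $x\rightsquigarrow y=((y\rightsquigarrow x)\rightarrow x)\rightsquigarrow y$; (c) for all $x,y\in A$: $(x\rightarrow y)\rightsquigarrow y=(((x\rightarrow y)\rightsquigarrow y)\rightarrow x)\rightsquigarrow x$ and $(x\rightsquigarrow y)\rightarrow y=(((x\rightsquigarrow y)\rightarrow y)\rightsquigarrow x)\rightarrow x$; (d) for all $x,y\in A$, $x\le y$ implies $y=(y\rightarrow x)\rightsquigarrow x=(y\rightsquigarrow x)\rightarrow x$.
   Context: A pseudo BCK-algebra is an algebra $(A,\rightarrow,\rightsquigarrow,1)$ of type $(2,2,0)$ such that for all $x,y,z\in A$: $(x\rightarrow y)\rightsquigarrow[(y\rightarrow z)\rightsquigarrow(x\rightarrow z)]=1$; $(x\rightsquigarrow y)\rightarrow[(y\rightsquigarrow z)\rightarrow(x\rightsquigarrow z)]=1$; $1\rightarrow x=x$; $1\rightsquigarrow x=x$; $x\rightarrow 1=1$; and if $x\rightarrow y=1$ and $y\rightarrow x=1$ then $x=y$. The partial order is $x\le y$ iff $x\rightarrow y=1$ (equivalently iff $x\rightsquigarrow y=1$). $A$ is commutative if $(x\rightarrow y)\rightsquigarrow y=(y\rightarrow x)\rightsquigarrow x$ and $(x\rightsquigarrow y)\rightarrow y=(y\rightsquigarrow x)\rightarrow x$ for all $x,y\in A$.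 -}

module Defs where

open import Level using (Level; suc)
open import Relation.Binary.PropositionalEquality using (_≡_)

record PseudoBCK (a : Level) : Set (suc a) where
  infixr 5 _⇒_ _⇝_
  field
    Carrier : Set a
    _⇒_     : Carrier → Carrier → Carrier
    _⇝_     : Carrier → Carrier → Carrier
    𝟏       : Carrier
    ax1     : ∀ x y z → (x ⇒ y) ⇝ ((y ⇒ z) ⇝ (x ⇒ z)) ≡ 𝟏
    ax2     : ∀ x y z → (x ⇝ y) ⇒ ((y ⇝ z) ⇒ (x ⇝ z)) ≡ 𝟏
    ax3     : ∀ x → 𝟏 ⇒ x ≡ x
    ax4     : ∀ x → 𝟏 ⇝ x ≡ x
    ax5     : ∀ x → x ⇒ 𝟏 ≡ 𝟏
    ax6     : ∀ x y → x ⇒ y ≡ 𝟏 → y ⇒ x ≡ 𝟏 → x ≡ y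

  _≤_ : Carrier → Carrier → Set a
  x ≤ y = x ⇒ y ≡ 𝟏

open import Data.Product using (_×_)

module _ {a : Level} (A : PseudoBCK a) where
  open PseudoBCK A

  IsCommutative : Set a
  IsCommutative = ∀ x y → ((x ⇒ y) ⇝ y ≡ (y ⇒ x) ⇝ x) × ((x ⇝ y) ⇒ y ≡ (y ⇝ x) ⇒ x)

-- Write x ⊔ y = (x → y) ⇝ y and x ⊔′ y = (x ⇝ y) → y; both are upper bounds of x and y
-- in every pseudo BCK-algebra, and x → y = (x ⊔ y) → y, x ⇝ y = (x ⊔′ y) ⇝ y hold always.
-- Commutativity says ⊔ and ⊔′ are symmetric, and each of (b), (c), (d) forces y ⊔ x = y ⊔′ x = y
-- whenever x ≤ y.  Conversely, under (d) the bound z = z ⊔ y for y ≤ z makes x ⊔ y and x ⊔′ y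
-- least upper bounds (by antitonicity of both arrows), hence symmetric by antisymmetry.
module Submission where

open import Defs
open import Level using (Level)
open import Data.Product using (_×_; _,_; proj₁; proj₂)
open import Function.Base using (_∘_)
open import Function.Bundles using (_⇔_; mk⇔)
open import Relation.Binary.PropositionalEquality
  using (_≡_; sym; trans; cong; subst; module ≡-Reasoning)

module PseudoBCKProperties {a : Level} (A : PseudoBCK a) where
  open PseudoBCK A
  open ≡-Reasoning

  infixl 6 _⊔_ _⊔′_

  _⊔_ : Carrier → Carrier → Carrier
  x ⊔ y = (x ⇒ y) ⇝ y

  _⊔′_ : Carrier → Carrier → Carrier
  x ⊔′ y = (x ⇝ y) ⇒ y

  x⇝x⊔y≡𝟏 : ∀ x y → x ⇝ (x ⊔ y) ≡ 𝟏
  x⇝x⊔y≡𝟏 x y = begin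
    x ⇝ ((x ⇒ y) ⇝ y)                 ≡⟨ cong (λ w → w ⇝ ((x ⇒ y) ⇝ y)) (sym (ax3 x)) ⟩
    (𝟏 ⇒ x) ⇝ ((x ⇒ y) ⇝ y)           ≡⟨ cong (λ w → (𝟏 ⇒ x) ⇝ ((x ⇒ y) ⇝ w)) (sym (ax3 y)) ⟩
    (𝟏 ⇒ x) ⇝ ((x ⇒ y) ⇝ (𝟏 ⇒ y))     ≡⟨ ax1 𝟏 x y ⟩
    𝟏                                 ∎

  x≤x⊔′y : ∀ x y → x ≤ (x ⊔′ y)
  x≤x⊔′y x y = begin
    x ⇒ ((x ⇝ y) ⇒ y)                 ≡⟨ cong (λ w → w ⇒ ((x ⇝ y) ⇒ y)) (sym (ax4 x)) ⟩
    (𝟏 ⇝ x) ⇒ ((x ⇝ y) ⇒ y)           ≡⟨ cong (λ w → (𝟏 ⇝ x) ⇒ ((x ⇝ y) ⇒ w)) (sym (ax4 y)) ⟩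
    (𝟏 ⇝ x) ⇒ ((x ⇝ y) ⇒ (𝟏 ⇝ y))     ≡⟨ ax2 𝟏 x y ⟩
    𝟏                                 ∎

  ≤⇒⇝≡𝟏 : ∀ {x y} → x ≤ y → x ⇝ y ≡ 𝟏
  ≤⇒⇝≡𝟏 {x} {y} x≤y = begin
    x ⇝ y              ≡⟨ cong (x ⇝_) (sym (ax4 y)) ⟩
    x ⇝ (𝟏 ⇝ y)        ≡⟨ cong (λ w → x ⇝ (w ⇝ y)) (sym x≤y) ⟩
    x ⇝ (x ⊔ y)        ≡⟨ x⇝x⊔y≡𝟏 x y ⟩
    𝟏                  ∎

  ⇝≡𝟏⇒≤ : ∀ {x y} → x ⇝ y ≡ 𝟏 → x ≤ y
  ⇝≡𝟏⇒≤ {x} {y} x⇝y≡𝟏 = begin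
    x ⇒ y              ≡⟨ cong (x ⇒_) (sym (ax3 y)) ⟩
    x ⇒ (𝟏 ⇒ y)        ≡⟨ cong (λ w → x ⇒ (w ⇒ y)) (sym x⇝y≡𝟏) ⟩
    x ⇒ (x ⊔′ y)       ≡⟨ x≤x⊔′y x y ⟩
    𝟏                  ∎

  x≤x⊔y : ∀ x y → x ≤ (x ⊔ y)
  x≤x⊔y x y = ⇝≡𝟏⇒≤ (x⇝x⊔y≡𝟏 x y)

  ⇒-antitoneˡ : ∀ {x y} z → x ≤ y → (y ⇒ z) ≤ (x ⇒ z)
  ⇒-antitoneˡ {x} {y} z x≤y = ⇝≡𝟏⇒≤ (begin
    (y ⇒ z) ⇝ (x ⇒ z)                   ≡⟨ sym (ax4 _) ⟩
    𝟏 ⇝ ((y ⇒ z) ⇝ (x ⇒ z))             ≡⟨ cong (λ w → w ⇝ ((y ⇒ z) ⇝ (x ⇒ z))) (sym x≤y) ⟩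
    (x ⇒ y) ⇝ ((y ⇒ z) ⇝ (x ⇒ z))       ≡⟨ ax1 x y z ⟩
    𝟏                                   ∎)

  ⇝-antitoneˡ : ∀ {x y} z → x ≤ y → (y ⇝ z) ≤ (x ⇝ z)
  ⇝-antitoneˡ {x} {y} z x≤y = begin
    (y ⇝ z) ⇒ (x ⇝ z)                   ≡⟨ sym (ax3 _) ⟩
    𝟏 ⇒ ((y ⇝ z) ⇒ (x ⇝ z))             ≡⟨ cong (λ w → w ⇒ ((y ⇝ z) ⇒ (x ⇝ z))) (sym (≤⇒⇝≡𝟏 x≤y)) ⟩
    (x ⇝ y) ⇒ ((y ⇝ z) ⇒ (x ⇝ z))       ≡⟨ ax2 x y z ⟩
    𝟏                                   ∎

  x≤y⇝x : ∀ x y → x ≤ (y ⇝ x)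
  x≤y⇝x x y = subst (_≤ (y ⇝ x)) (ax4 x) (⇝-antitoneˡ x (ax5 y))

  x≤y⇒x : ∀ x y → x ≤ (y ⇒ x)
  x≤y⇒x x y = subst (_≤ (y ⇒ x)) (ax3 x) (⇒-antitoneˡ x (ax5 y))

  y≤x⊔y : ∀ x y → y ≤ (x ⊔ y)
  y≤x⊔y x y = x≤y⇝x y (x ⇒ y)

  y≤x⊔′y : ∀ x y → y ≤ (x ⊔′ y)
  y≤x⊔′y x y = x≤y⇒x y (x ⇝ y)

  ≤⇒x⊔y≡y : ∀ {x y} → x ≤ y → x ⊔ y ≡ y
  ≤⇒x⊔y≡y {x} {y} x≤y = trans (cong (_⇝ y) x≤y) (ax4 y)

  ≤⇒x⊔′y≡y : ∀ {x y} → x ≤ y → x ⊔′ y ≡ y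
  ≤⇒x⊔′y≡y {x} {y} x≤y = trans (cong (_⇒ y) (≤⇒⇝≡𝟏 x≤y)) (ax3 y)

  ⇒≡⊔⇒ : ∀ x y → x ⇒ y ≡ (x ⊔ y) ⇒ y
  ⇒≡⊔⇒ x y = ax6 _ _ (x≤x⊔′y (x ⇒ y) y) (⇒-antitoneˡ y (x≤x⊔y x y))

  ⇝≡⊔′⇝ : ∀ x y → x ⇝ y ≡ (x ⊔′ y) ⇝ y
  ⇝≡⊔′⇝ x y = ax6 _ _ (x≤x⊔y (x ⇝ y) y) (⇝-antitoneˡ y (x≤x⊔′y x y))

  ArrowsAbsorbJoins : Set a
  ArrowsAbsorbJoins = ∀ x y → (x ⇒ y ≡ (y ⊔ x) ⇒ y) × (x ⇝ y ≡ (y ⊔′ x) ⇝ y)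

  JoinsAbsorbLeft : Set a
  JoinsAbsorbLeft = ∀ x y → (x ⊔ y ≡ (x ⊔ y) ⊔ x) × (x ⊔′ y ≡ (x ⊔′ y) ⊔′ x)

  JoinsOfComparables : Set a
  JoinsOfComparables = ∀ x y → x ≤ y → (y ≡ y ⊔ x) × (y ⊔ x ≡ y ⊔′ x)

  joinsOfComparables : (∀ {x y} → x ≤ y → (y ⊔ x ≡ y) × (y ⊔′ x ≡ y)) → JoinsOfComparables
  joinsOfComparables absorb x y x≤y with absorb x≤y
  ... | y⊔x≡y , y⊔′x≡y = sym y⊔x≡y , trans y⊔x≡y (sym y⊔′x≡y)

  commutative⇒joinsOfComparables : IsCommutative A → JoinsOfComparables
  commutative⇒joinsOfComparables comm = joinsOfComparables λ {x} {y} x≤y →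
      trans (sym (proj₁ (comm x y))) (≤⇒x⊔y≡y x≤y)
    , trans (sym (proj₂ (comm x y))) (≤⇒x⊔′y≡y x≤y)

  module _ (d : JoinsOfComparables) where

    ⊔-least : ∀ {x y z} → x ≤ z → y ≤ z → (x ⊔ y) ≤ z
    ⊔-least {x} {y} {z} x≤z y≤z =
      subst ((x ⊔ y) ≤_) (sym (proj₁ (d y z y≤z))) (⇝-antitoneˡ y (⇒-antitoneˡ y x≤z))

    ⊔′-least : ∀ {x y z} → x ≤ z → y ≤ z → (x ⊔′ y) ≤ z
    ⊔′-least {x} {y} {z} x≤z y≤z =
      subst ((x ⊔′ y) ≤_) (sym (trans (proj₁ (d y z y≤z)) (proj₂ (d y z y≤z))))
        (⇒-antitoneˡ y (⇝-antitoneˡ y x≤z))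

    joinsOfComparables⇒commutative : IsCommutative A
    joinsOfComparables⇒commutative x y =
        ax6 _ _ (⊔-least (y≤x⊔y y x) (x≤x⊔y y x)) (⊔-least (y≤x⊔y x y) (x≤x⊔y x y))
      , ax6 _ _ (⊔′-least (y≤x⊔′y y x) (x≤x⊔′y y x)) (⊔′-least (y≤x⊔′y x y) (x≤x⊔′y x y))

    joinsOfComparables⇒joinsAbsorbLeft : JoinsAbsorbLeft
    joinsOfComparables⇒joinsAbsorbLeft x y =
        proj₁ (d x (x ⊔ y) (x≤x⊔y x y))
      , trans (proj₁ (d x (x ⊔′ y) (x≤x⊔′y x y))) (proj₂ (d x (x ⊔′ y) (x≤x⊔′y x y)))

  commutative⇒arrowsAbsorbJoins : IsCommutative A → ArrowsAbsorbJoins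
  commutative⇒arrowsAbsorbJoins comm x y =
      trans (⇒≡⊔⇒ x y) (cong (_⇒ y) (proj₁ (comm x y)))
    , trans (⇝≡⊔′⇝ x y) (cong (_⇝ y) (proj₂ (comm x y)))

  arrowsAbsorbJoins⇒joinsOfComparables : ArrowsAbsorbJoins → JoinsOfComparables
  arrowsAbsorbJoins⇒joinsOfComparables b = joinsOfComparables λ {x} {y} x≤y →
      ax6 _ _ (trans (sym (proj₁ (b x y))) x≤y) (x≤x⊔y y x)
    , ax6 _ _ (⇝≡𝟏⇒≤ (trans (sym (proj₂ (b x y))) (≤⇒⇝≡𝟏 x≤y))) (x≤x⊔′y y x)

  joinsAbsorbLeft⇒joinsOfComparables : JoinsAbsorbLeft → JoinsOfComparables
  joinsAbsorbLeft⇒joinsOfComparables c = joinsOfComparables λ {x} {y} x≤y →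
      sym (subst (λ w → w ≡ w ⊔ x) (≤⇒x⊔y≡y x≤y) (proj₁ (c x y)))
    , sym (subst (λ w → w ≡ w ⊔′ x) (≤⇒x⊔′y≡y x≤y) (proj₂ (c x y)))

theorem3p9 : ∀ {a : Level} (A : PseudoBCK a) → let open PseudoBCK A in
    (IsCommutative A ⇔ (∀ x y → (x ⇒ y ≡ ((y ⇒ x) ⇝ x) ⇒ y) × (x ⇝ y ≡ ((y ⇝ x) ⇒ x) ⇝ y)))
    × (IsCommutative A ⇔ (∀ x y → ((x ⇒ y) ⇝ y ≡ (((x ⇒ y) ⇝ y) ⇒ x) ⇝ x) × ((x ⇝ y) ⇒ y ≡ (((x ⇝ y) ⇒ y) ⇝ x) ⇒ x)))
    × (IsCommutative A ⇔ (∀ x y → x ≤ y → (y ≡ (y ⇒ x) ⇝ x) × ((y ⇒ x) ⇝ x ≡ (y ⇝ x) ⇒ x)))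
theorem3p9 A =
    mk⇔ commutative⇒arrowsAbsorbJoins
        (joinsOfComparables⇒commutative ∘ arrowsAbsorbJoins⇒joinsOfComparables)
  , mk⇔ (joinsOfComparables⇒joinsAbsorbLeft ∘ commutative⇒joinsOfComparables)
        (joinsOfComparables⇒commutative ∘ joinsAbsorbLeft⇒joinsOfComparables)
  , mk⇔ commutative⇒joinsOfComparables joinsOfComparables⇒commutative
  where open PseudoBCKProperties A
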